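{- Let $G$ be a graph, $X\subseteq V(G)$, and $k\ge 1$ an integer, and assume $|\delta(X)|\ge \frac32 k$. Then $G$ contains an $X$-spider of order $k$ if and only if there does not exist a partition $U_1,\dots,U_m$ of $V(G)\setminus X$ such that $|\delta(U_i)|<k$ for all $1\le i\le m$.
   Context: Graphs may have parallel edges but no loops. $\delta(Y)$ is the set of edges with exactly one end in $Y$. An $X$-spider of order $k$ consists of a vertex $v\in V(G)\setminus X$ (its body) and $k$ pairwise edge-disjoint paths $P_1,\dots,P_k$, each with one endpoint $v$, the other endpoint in $X$, and no internal vertex in $X$. -}

module Defs where

open import Data.Nat using (ℕ; zero; suc; _+_; _<_)
open import Data.Bool using (Bool; true; false; _xor_; if_then_else_; not; _∧_)
open import Relation.Nullary.Decidable using (⌊_⌋)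
open import Data.Fin using (Fin; toℕ; inject₁; _≟_; fromℕ) renaming (zero to fz; suc to fs)
open import Data.Product using (Σ; _×_; _,_; proj₁; proj₂)
open import Data.Sum using (_⊎_)
open import Relation.Binary.PropositionalEquality using (_≡_; _≢_)
open import Function.Definitions using (Injective)

record Graph : Set where
  field
    nV : ℕ
    nE : ℕ
    ends : Fin nE → Fin nV × Fin nV
    noLoop : ∀ e → proj₁ (ends e) ≢ proj₂ (ends e)
open Graph public

VSet : Graph → Set
VSet G = Fin (nV G) → Bool

count : ∀ {m} → (Fin m → Bool) → ℕ
count {zero} f = 0
count {suc m} f = (if f fz then 1 else 0) + count (λ i → f (fs i))

δsize : (G : Graph) → VSet G → ℕ
δsize G Y = count (λ e → Y (proj₁ (ends G e)) xor Y (proj₂ (ends G e)))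

Joins : (G : Graph) → Fin (nE G) → Fin (nV G) → Fin (nV G) → Set
Joins G e a b = ends G e ≡ (a , b) ⊎ ends G e ≡ (b , a)

record Path (G : Graph) : Set where
  field
    len   : ℕ
    verts : Fin (suc len) → Fin (nV G)
    edges : Fin len → Fin (nE G)
    adj   : ∀ i → Joins G (edges i) (verts (inject₁ i)) (verts (fs i))
    distinct : Injective _≡_ _≡_ verts
open Path public

start : ∀ {G} → Path G → Fin (nV G)
start P = verts P fz

end : ∀ {G} → (P : Path G) → Fin (nV G)
end P = verts P (fromℕ (len P))

IsSpider : (G : Graph) (X : VSet G) (k : ℕ) → Set
IsSpider G X k =
  Σ (Fin (nV G)) λ v → X v ≡ false ×
  Σ (Fin k → Path G) λ P →
    (∀ i → start (P i) ≡ v) ×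
    (∀ i → X (end (P i)) ≡ true) ×
    (∀ i (j : Fin (suc (len (P i)))) → 0 < toℕ j → toℕ j < len (P i) →
        X (verts (P i) j) ≡ false) ×
    (∀ i i' → i ≢ i' → ∀ a b → edges (P i) a ≢ edges (P i') b)

-- Partition U_1..U_p of V(G)∖X into nonempty parts, given by a part-assignment
-- c : V → Fin p (only values on V∖X matter); U_i = {v ∉ X | c v = i}.
Part : (G : Graph) (X : VSet G) {p : ℕ} → (Fin (nV G) → Fin p) → Fin p → VSet G
Part G X c i v = not (X v) ∧ ⌊ c v ≟ i ⌋

HasSmallPartition : (G : Graph) (X : VSet G) (k : ℕ) → Set
HasSmallPartition G X k =
  Σ ℕ λ p → Σ (Fin (nV G) → Fin p) λ c →
    (∀ i → Σ (Fin (nV G)) λ v → Part G X c i v ≡ true) ×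
    (∀ i → δsize G (Part G X c i) < k)

-- By Menger's theorem a vertex v ∉ X is either the body of a spider of order k or lies in a set
-- S disjoint from X with |δ(S)| < k.  If no vertex is a body, these small sets cover V∖X, and since
-- |δ| is posimodular, |δ(A∖B)| + |δ(B∖A)| ≤ |δ(A)| + |δ(B)|, they can be uncrossed one at a time
-- into disjoint small sets whose nonempty members form a forbidden partition.  Conversely, every leg
-- of a spider leaves the part containing its body, so that part has at least k boundary edges.
-- Menger's theorem is proved with unit-capacity integer flows: a flow of value j either augments
-- along a residual walk to X, or the vertices that reach X in the residual graph span a cut of size
-- exactly j; a flow of value k splits into k legs by repeatedly cancelling a walk along its support.

module Submission where

open import Defs
import Algebra.Properties.CommutativeSemigroup
import Algebra.Properties.Semiring.Sum as SemiringSum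
open import Data.Bool using (Bool; true; false; if_then_else_; not; _∧_; _∨_; _xor_)
open import Data.Bool.Properties using (∨-identityʳ; ∨-zeroʳ; ∧-zeroʳ)
open import Data.Empty using (⊥; ⊥-elim)
open import Data.Fin using (Fin; _≟_; toℕ; fromℕ; inject₁) renaming (zero to fz; suc to fs)
import Data.Fin.Properties as FinP
open import Data.Integer as ℤ using (ℤ; +_; 0ℤ)
import Data.Integer.Properties as ℤP
open import Data.List as List using (List; []; _∷_)
open import Data.List.Membership.Propositional.Properties using (∈-lookup)
open import Data.List.Relation.Unary.All as All using (All; []; _∷_)
open import Data.Nat as ℕ using (ℕ; zero; suc)
import Data.Nat.Properties as ℕP
open import Data.Product using (∃; _×_; _,_; proj₁; proj₂)
open import Data.Sum using (_⊎_; inj₁; inj₂)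
open import Data.Unit using (⊤; tt)
open import Data.Vec.Functional using () renaming (_∷_ to _◃_)
open import Function using (_∘_)
open import Function.Bundles using (_⇔_; mk⇔)
open import Function.Definitions using (Injective)
open import Relation.Binary.PropositionalEquality
open import Relation.Nullary using (¬_; Dec; does; yes; no)
open import Relation.Nullary.Decidable using (dec-true; dec-false; isYes≗does)

open SemiringSum ℤP.+-*-semiring
  using (sum; ∑-distrib-+; ∑-comm; *-distribˡ-sum; sum-cong-≗; sum-replicate-zero)

false≢true : false ≢ true
false≢true ()

does⇒ : ∀ {a} {A : Set a} (a? : Dec A) → does a? ≡ true → A
does⇒ (yes a) _ = a

not-does⇒¬ : ∀ {a} {A : Set a} (a? : Dec A) → not (does a?) ≡ true → ¬ A
not-does⇒¬ (no ¬a) _ = ¬a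

keep-union : ∀ a b c → b ∨ ((a ∧ not b) ∨ c) ≡ a ∨ (b ∨ c)
keep-union a     true  c = sym (∨-zeroʳ a)
keep-union true  false c = refl
keep-union false false c = refl

replace-union : ∀ a b c → (b ∧ not a) ∨ (a ∨ c) ≡ a ∨ (b ∨ c)
replace-union true  b     c = ∨-zeroʳ (b ∧ false)
replace-union false true  c = refl
replace-union false false c = refl

keep-apart : ∀ a b {c} → b ∧ c ≡ false → b ∧ ((a ∧ not b) ∨ c) ≡ false
keep-apart a     false apart = refl
keep-apart true  true  apart = apart
keep-apart false true  apart = apart

replace-apart : ∀ a b {c} → b ∧ c ≡ false → (b ∧ not a) ∧ (a ∨ c) ≡ false
replace-apart true  b     apart = cong (_∧ true) (∧-zeroʳ b)
replace-apart false false apart = refl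
replace-apart false true  apart = apart

both-true : ∀ {a b} → a ∧ b ≡ false → a ≡ true → b ≡ true → ⊥
both-true apart refl refl = false≢true (sym apart)

first-exit : ∀ {n} (f : Fin (suc n) → Bool) → f fz ≡ true → f (fromℕ n) ≡ false →
  ∃ λ a → f (inject₁ a) ≡ true × f (fs a) ≡ false
first-exit {zero}  f first last = ⊥-elim (false≢true (trans (sym last) first))
first-exit {suc n} f first last with f (fs fz) in second
... | false = fz , first , second
... | true with first-exit (f ∘ fs) second last
...   | a , inside , outside = fs a , inside , outside

find-true : ∀ {n} (f : Fin n → Bool) → (∃ λ i → f i ≡ true) ⊎ (∀ i → f i ≡ false)
find-true {zero} f = inj₂ λ ()
find-true {suc n} f with f fz in eq | find-true (f ∘ fs)
... | true  | _               = inj₁ (fz , eq)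
... | false | inj₁ (i , fi)   = inj₁ (fs i , fi)
... | false | inj₂ none       = inj₂ λ { fz → eq ; (fs i) → none i }

module Counting where

  open import Data.Nat using (_+_; _≤_; _<_; z≤n; s≤s)
  open Algebra.Properties.CommutativeSemigroup ℕP.+-commutativeSemigroup using (interchange)

  𝟙 : Bool → ℕ
  𝟙 b = if b then 1 else 0

  count-cong : ∀ {m} {f g : Fin m → Bool} → (∀ i → f i ≡ g i) → count f ≡ count g
  count-cong {zero}  f≗g = refl
  count-cong {suc m} f≗g = cong₂ (λ b n → 𝟙 b + n) (f≗g fz) (count-cong (f≗g ∘ fs))

  count≤ : ∀ {m} (f : Fin m → Bool) → count f ≤ m
  count≤ {zero}  f = z≤n
  count≤ {suc m} f with f fz
  ... | true  = s≤s (count≤ (f ∘ fs))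
  ... | false = ℕP.m≤n⇒m≤1+n (count≤ (f ∘ fs))

  count< : ∀ {m} (f : Fin m → Bool) {i} → f i ≡ false → count f < m
  count< f {fz} fi≡false rewrite fi≡false = s≤s (count≤ (f ∘ fs))
  count< f {fs i} fi≡false with f fz
  ... | true  = s≤s (count< (f ∘ fs) fi≡false)
  ... | false = ℕP.m≤n⇒m≤1+n (count< (f ∘ fs) fi≡false)

  count≥⇒all-true : ∀ {m} (f : Fin m → Bool) → m ≤ count f → ∀ i → f i ≡ true
  count≥⇒all-true f m≤count i with f i in eq
  ... | true  = refl
  ... | false = ⊥-elim (ℕP.<⇒≱ (count< f eq) m≤count)

  count>0⇒∃ : ∀ {m} (f : Fin m → Bool) → 0 < count f → ∃ λ i → f i ≡ true
  count>0⇒∃ {suc m} f pos with f fz in eq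
  ... | true  = fz , eq
  ... | false with count>0⇒∃ (f ∘ fs) pos
  ...   | i , fi = fs i , fi

  count-insert : ∀ {m} (f : Fin m → Bool) {u} → f u ≡ false →
    count (λ w → f w ∨ does (w ≟ u)) ≡ suc (count f)
  count-insert {suc m} f {fz} fu≡false rewrite fu≡false =
    cong suc (count-cong λ i → ∨-identityʳ (f (fs i)))
  count-insert {suc m} f {fs u} fu≡false
    rewrite ∨-identityʳ (f fz) with f fz
  ... | true  = cong suc (count-insert (f ∘ fs) fu≡false)
  ... | false = count-insert (f ∘ fs) fu≡false

  count-+-mono-≤ : ∀ {m} {f g f′ g′ : Fin m → Bool} →
    (∀ i → 𝟙 (f i) + 𝟙 (g i) ≤ 𝟙 (f′ i) + 𝟙 (g′ i)) →
    count f + count g ≤ count f′ + count g′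
  count-+-mono-≤ {zero}  _ = z≤n
  count-+-mono-≤ {suc m} {f} {g} {f′} {g′} pointwise = begin
    (𝟙 (f fz) + count (f ∘ fs)) + (𝟙 (g fz) + count (g ∘ fs))
      ≡⟨ interchange (𝟙 (f fz)) _ (𝟙 (g fz)) _ ⟩
    (𝟙 (f fz) + 𝟙 (g fz)) + (count (f ∘ fs) + count (g ∘ fs))
      ≤⟨ ℕP.+-mono-≤ (pointwise fz) (count-+-mono-≤ (pointwise ∘ fs)) ⟩
    (𝟙 (f′ fz) + 𝟙 (g′ fz)) + (count (f′ ∘ fs) + count (g′ ∘ fs))
      ≡⟨ interchange (𝟙 (f′ fz)) (𝟙 (g′ fz)) _ _ ⟩
    (𝟙 (f′ fz) + count (f′ ∘ fs)) + (𝟙 (g′ fz) + count (g′ ∘ fs)) ∎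
    where open ℕP.≤-Reasoning

  rank : ∀ {m} (f : Fin m → Bool) (i : Fin m) → f i ≡ true → Fin (count f)
  rank f fz     fi with f fz
  ... | true = fz
  rank f (fs i) fi with f fz
  ... | true  = fs (rank (f ∘ fs) i fi)
  ... | false = rank (f ∘ fs) i fi

  rank-injective : ∀ {m} (f : Fin m → Bool) {i j} (fi : f i ≡ true) (fj : f j ≡ true) →
    rank f i fi ≡ rank f j fj → i ≡ j
  rank-injective f {fz}   {fz}   _  _  _  = refl
  rank-injective f {fz}   {fs j} fi fj eq with f fz
  rank-injective f {fz}   {fs j} fi fj () | true
  rank-injective f {fs i} {fz}   fi fj eq with f fz
  rank-injective f {fs i} {fz}   fi fj () | true
  rank-injective f {fs i} {fs j} fi fj eq with f fz
  ... | true  = cong fs (rank-injective (f ∘ fs) fi fj (FinP.suc-injective eq))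
  ... | false = cong fs (rank-injective (f ∘ fs) fi fj eq)

  injection⇒≤count : ∀ {k m} (f : Fin m → Bool) (g : Fin k → Fin m) →
    Injective _≡_ _≡_ g → (∀ i → f (g i) ≡ true) → k ≤ count f
  injection⇒≤count f g g-inj fg =
    FinP.injective⇒≤ (λ eq → g-inj (rank-injective f (fg _) (fg _) eq))

open Counting

sum-zero : ∀ {n} {f : Fin n → ℤ} → (∀ i → f i ≡ 0ℤ) → sum f ≡ 0ℤ
sum-zero {n} f≗0 = trans (sum-cong-≗ f≗0) (sum-replicate-zero n)

sum-single : ∀ {n} (f : Fin n → ℤ) w → (∀ i → i ≢ w → f i ≡ 0ℤ) → sum f ≡ f w
sum-single f fz     vanish = trans (cong (ℤ._+_ (f fz)) (sum-zero λ i → vanish (fs i) λ ()))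
                                   (ℤP.+-identityʳ (f fz))
sum-single f (fs w) vanish =
  trans (cong (ℤ._+ sum (f ∘ fs)) (vanish fz λ ()))
        (trans (ℤP.+-identityˡ _)
               (sum-single (f ∘ fs) w λ i i≢w → vanish (fs i) (i≢w ∘ FinP.suc-injective)))

sum-mono-≤ : ∀ {n} {f g : Fin n → ℤ} → (∀ i → f i ℤ.≤ g i) → sum f ℤ.≤ sum g
sum-mono-≤ {zero}  f≤g = ℤP.≤-refl
sum-mono-≤ {suc n} f≤g = ℤP.+-mono-≤ (f≤g fz) (sum-mono-≤ (f≤g ∘ fs))

sum-𝟙 : ∀ {n} (b : Fin n → Bool) → sum (λ i → + 𝟙 (b i)) ≡ + count b
sum-𝟙 {zero}  b = refl
sum-𝟙 {suc n} b with b fz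
... | true  = cong (ℤ._+_ (+ 1)) (sum-𝟙 (b ∘ fs))
... | false = trans (ℤP.+-identityˡ _) (sum-𝟙 (b ∘ fs))

module _ (G : Graph) where

  open import Data.Integer using (1ℤ; -1ℤ; _+_; _-_; _*_)
  open import Data.Integer.Tactic.RingSolver using (solve-∀)

  V E : Set
  V = Fin (nV G)
  E = Fin (nE G)

  src tgt : E → V
  src e = proj₁ (ends G e)
  tgt e = proj₂ (ends G e)

  ⟦_≟_⟧ : V → V → ℤ
  ⟦ u ≟ w ⟧ = + 𝟙 (does (u ≟ w))

  ⟦≟⟧-refl : ∀ w → ⟦ w ≟ w ⟧ ≡ 1ℤ
  ⟦≟⟧-refl w rewrite dec-true (w ≟ w) refl = refl

  ⟦≟⟧-≢ : ∀ {u w} → u ≢ w → ⟦ u ≟ w ⟧ ≡ 0ℤ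
  ⟦≟⟧-≢ {u} {w} u≢w rewrite dec-false (u ≟ w) u≢w = refl

  sum-⟦≟⟧ : (a : V → ℤ) (w : V) → sum (λ u → a u * ⟦ u ≟ w ⟧) ≡ a w
  sum-⟦≟⟧ a w = begin
    sum (λ u → a u * ⟦ u ≟ w ⟧) ≡⟨ sum-single _ w vanish ⟩
    a w * ⟦ w ≟ w ⟧             ≡⟨ cong (a w *_) (⟦≟⟧-refl w) ⟩
    a w * 1ℤ                    ≡⟨ ℤP.*-identityʳ (a w) ⟩
    a w                         ∎
    where
    open ≡-Reasoning
    vanish : ∀ u → u ≢ w → a u * ⟦ u ≟ w ⟧ ≡ 0ℤ
    vanish u u≢w = trans (cong (a u *_) (⟦≟⟧-≢ u≢w)) (ℤP.*-zeroʳ (a u))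

  incidence : E → V → ℤ
  incidence e u = ⟦ u ≟ src e ⟧ - ⟦ u ≟ tgt e ⟧

  outflow : (E → ℤ) → V → ℤ
  outflow φ u = sum (λ e → φ e * incidence e u)

  outflow-+ : ∀ φ ψ u → outflow (λ e → φ e + ψ e) u ≡ outflow φ u + outflow ψ u
  outflow-+ φ ψ u = trans (sum-cong-≗ λ e → ℤP.*-distribʳ-+ (incidence e u) (φ e) (ψ e))
                          (∑-distrib-+ (λ e → φ e * incidence e u) (λ e → ψ e * incidence e u))

  outflow-* : ∀ c φ u → outflow (λ e → c * φ e) u ≡ c * outflow φ u
  outflow-* c φ u = trans (sum-cong-≗ λ e → ℤP.*-assoc c (φ e) (incidence e u))
                          (sym (*-distribˡ-sum c (λ e → φ e * incidence e u)))

  sum-incidence : (a : V → ℤ) (e : E) → sum (λ u → a u * incidence e u) ≡ a (src e) - a (tgt e)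
  sum-incidence a e = begin
    sum (λ u → a u * incidence e u)
      ≡⟨ sum-cong-≗ (λ u → split (a u) _ _) ⟩
    sum (λ u → at-src u + -1ℤ * at-tgt u)
      ≡⟨ ∑-distrib-+ at-src (λ u → -1ℤ * at-tgt u) ⟩
    sum at-src + sum (λ u → -1ℤ * at-tgt u)
      ≡⟨ cong (_+_ (sum at-src)) (sym (*-distribˡ-sum -1ℤ at-tgt)) ⟩
    sum at-src + -1ℤ * sum at-tgt
      ≡⟨ cong₂ (λ x y → x + -1ℤ * y) (sum-⟦≟⟧ a (src e)) (sum-⟦≟⟧ a (tgt e)) ⟩
    a (src e) + -1ℤ * a (tgt e)
      ≡⟨ join (a (src e)) (a (tgt e)) ⟩
    a (src e) - a (tgt e) ∎
    where
    open ≡-Reasoning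
    at-src at-tgt : V → ℤ
    at-src u = a u * ⟦ u ≟ src e ⟧
    at-tgt u = a u * ⟦ u ≟ tgt e ⟧
    split : ∀ x y z → x * (y - z) ≡ x * y + -1ℤ * (x * z)
    split = solve-∀
    join : ∀ x y → x + -1ℤ * y ≡ x - y
    join = solve-∀

  sum-by-parts : (a : V → ℤ) (φ : E → ℤ) →
    sum (λ u → a u * outflow φ u) ≡ sum (λ e → φ e * (a (src e) - a (tgt e)))
  sum-by-parts a φ = begin
    sum (λ u → a u * outflow φ u)
      ≡⟨ sum-cong-≗ (λ u → *-distribˡ-sum (a u) (λ e → φ e * incidence e u)) ⟩
    sum (λ u → sum (λ e → a u * (φ e * incidence e u)))
      ≡⟨ ∑-comm (λ u e → a u * (φ e * incidence e u)) ⟩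
    sum (λ e → sum (λ u → a u * (φ e * incidence e u)))
      ≡⟨ sum-cong-≗ (λ e → sum-cong-≗ (λ u → swap (a u) (φ e) _)) ⟩
    sum (λ e → sum (λ u → φ e * (a u * incidence e u)))
      ≡⟨ sum-cong-≗ (λ e → sym (*-distribˡ-sum (φ e) (λ u → a u * incidence e u))) ⟩
    sum (λ e → φ e * sum (λ u → a u * incidence e u))
      ≡⟨ sum-cong-≗ (λ e → cong (φ e *_) (sum-incidence a e)) ⟩
    sum (λ e → φ e * (a (src e) - a (tgt e))) ∎
    where
    open ≡-Reasoning
    swap : ∀ x y z → x * (y * z) ≡ y * (x * z)
    swap = solve-∀

  from to : E → Bool → V
  from e s = if s then src e else tgt e
  to   e s = if s then tgt e else src e

  sgn : Bool → ℤ
  sgn true  = 1ℤ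
  sgn false = -1ℤ

  sgn-incidence : ∀ s e u → sgn s * incidence e u ≡ ⟦ u ≟ from e s ⟧ - ⟦ u ≟ to e s ⟧
  sgn-incidence true  e u = ℤP.*-identityˡ _
  sgn-incidence false e u = negate ⟦ u ≟ src e ⟧ ⟦ u ≟ tgt e ⟧
    where
    negate : ∀ x y → -1ℤ * (x - y) ≡ y - x
    negate = solve-∀

  from-to-joins : ∀ e s → Joins G e (from e s) (to e s)
  from-to-joins e true  = inj₁ refl
  from-to-joins e false = inj₂ refl

  from-endpoint : ∀ e s s′ → from e s ≡ from e s′ ⊎ from e s ≡ to e s′
  from-endpoint e true  true  = inj₁ refl
  from-endpoint e true  false = inj₂ refl
  from-endpoint e false true  = inj₂ refl
  from-endpoint e false false = inj₁ refl

  arcFlow : E → Bool → E → ℤ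
  arcFlow e s e′ = if does (e′ ≟ e) then sgn s else 0ℤ

  outflow-arcFlow : ∀ e s u →
    outflow (arcFlow e s) u ≡ ⟦ u ≟ from e s ⟧ - ⟦ u ≟ to e s ⟧
  outflow-arcFlow e s u = begin
    outflow (arcFlow e s) u           ≡⟨ sum-single _ e vanish ⟩
    arcFlow e s e * incidence e u     ≡⟨ cong (_* incidence e u) on-e ⟩
    sgn s * incidence e u             ≡⟨ sgn-incidence s e u ⟩
    ⟦ u ≟ from e s ⟧ - ⟦ u ≟ to e s ⟧ ∎
    where
    open ≡-Reasoning
    on-e : arcFlow e s e ≡ sgn s
    on-e rewrite dec-true (e ≟ e) refl = refl
    vanish : ∀ e′ → e′ ≢ e → arcFlow e s e′ * incidence e′ u ≡ 0ℤ
    vanish e′ e′≢e rewrite dec-false (e′ ≟ e) e′≢e = refl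

  _⊆_ : VSet G → VSet G → Set
  R ⊆ S = ∀ u → R u ≡ true → S u ≡ true

  insert : V → VSet G → VSet G
  insert u R w = R w ∨ does (w ≟ u)

  ⊆-insert : ∀ u R → R ⊆ insert u R
  ⊆-insert u R w Rw rewrite Rw = refl

  ∈-insert : ∀ u R → insert u R u ≡ true
  ∈-insert u R rewrite dec-true (u ≟ u) refl = ∨-zeroʳ (R u)

  module Walks (X : VSet G) (A : E → Bool → Bool) where

    data Walk : V → Set where
      stop : ∀ {x} → X x ≡ true → Walk x
      step : ∀ {u} e s → A e s ≡ true → from e s ≡ u → X u ≡ false →
             Walk (to e s) → Walk u

    Visits : ∀ {u} → V → Walk u → Set
    Visits w (stop {x} _)           = w ≡ x
    Visits w (step {u} _ _ _ _ _ p) = w ≡ u ⊎ Visits w p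

    Uses : ∀ {u} → E → Bool → Walk u → Set
    Uses e s (stop _)                = ⊥
    Uses e s (step e′ s′ _ _ _ p)    = (e ≡ e′ × s ≡ s′) ⊎ Uses e s p

    Simple : ∀ {u} → Walk u → Set
    Simple (stop _)                  = ⊤
    Simple (step {u} _ _ _ _ _ p)    = ¬ Visits u p × Simple p

    terminus : ∀ {u} → Walk u → V
    terminus (stop {x} _)         = x
    terminus (step _ _ _ _ _ p)   = terminus p

    terminus∈X : ∀ {u} (p : Walk u) → X (terminus p) ≡ true
    terminus∈X (stop x∈X)         = x∈X
    terminus∈X (step _ _ _ _ _ p) = terminus∈X p

    visits-origin : ∀ {u} (p : Walk u) → Visits u p
    visits-origin (stop _)           = refl
    visits-origin (step _ _ _ _ _ _) = inj₁ refl

    uses⇒admissible : ∀ {u e s} (p : Walk u) → Uses e s p → A e s ≡ true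
    uses⇒admissible (step _ _ a _ _ _) (inj₁ (refl , refl)) = a
    uses⇒admissible (step _ _ _ _ _ p) (inj₂ use)           = uses⇒admissible p use

    uses⇒visits : ∀ {u e s} (p : Walk u) → Uses e s p → Visits (from e s) p × Visits (to e s) p
    uses⇒visits (step _ _ _ eq _ p) (inj₁ (refl , refl)) = inj₁ eq , inj₂ (visits-origin p)
    uses⇒visits (step _ _ _ _ _ p)  (inj₂ use) with uses⇒visits p use
    ... | visits-from , visits-to = inj₂ visits-from , inj₂ visits-to

    walkFlow : ∀ {u} → Walk u → E → ℤ
    walkFlow (stop _)           e = 0ℤ
    walkFlow (step e′ s _ _ _ p) e = arcFlow e′ s e + walkFlow p e

    outflow-walkFlow : ∀ {u} (p : Walk u) w →
      outflow (walkFlow p) w ≡ ⟦ w ≟ u ⟧ - ⟦ w ≟ terminus p ⟧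
    outflow-walkFlow (stop {x} _) w =
      trans (sum-zero λ e → ℤP.*-zeroˡ (incidence e w)) (sym (ℤP.+-inverseʳ ⟦ w ≟ x ⟧))
    outflow-walkFlow (step e s a refl x∉X p) w = begin
      outflow (walkFlow (step e s a refl x∉X p)) w
        ≡⟨ outflow-+ (arcFlow e s) (walkFlow p) w ⟩
      outflow (arcFlow e s) w + outflow (walkFlow p) w
        ≡⟨ cong₂ _+_ (outflow-arcFlow e s w) (outflow-walkFlow p w) ⟩
      (⟦ w ≟ from e s ⟧ - ⟦ w ≟ to e s ⟧) + (⟦ w ≟ to e s ⟧ - ⟦ w ≟ terminus p ⟧)
        ≡⟨ telescope ⟦ w ≟ from e s ⟧ ⟦ w ≟ to e s ⟧ ⟦ w ≟ terminus p ⟧ ⟩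
      ⟦ w ≟ from e s ⟧ - ⟦ w ≟ terminus p ⟧ ∎
      where
      open ≡-Reasoning
      telescope : ∀ x y z → (x - y) + (y - z) ≡ x - z
      telescope = solve-∀

    walkFlow-simple : ∀ {u} (p : Walk u) → Simple p → ∀ e →
      (walkFlow p e ≡ 0ℤ × (∀ s → ¬ Uses e s p)) ⊎ (∃ λ s → Uses e s p × walkFlow p e ≡ sgn s)
    walkFlow-simple (stop _) _ e = inj₁ (refl , λ _ ())
    walkFlow-simple (step e₀ s₀ _ u≡from _ p) (u∉p , p-simple) e with e ≟ e₀
    ... | yes refl with walkFlow-simple p p-simple e₀
    ...   | inj₁ (flow≡0 , _) =
      inj₂ (s₀ , inj₁ (refl , refl) , trans (cong (_+_ (sgn s₀)) flow≡0) (ℤP.+-identityʳ (sgn s₀)))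
    ...   | inj₂ (s , use , _) = ⊥-elim (u∉p (subst (λ w → Visits w p) u≡from
                                    (endpoint-visited (from-endpoint e₀ s₀ s) (uses⇒visits p use))))
      where
      endpoint-visited : from e₀ s₀ ≡ from e₀ s ⊎ from e₀ s₀ ≡ to e₀ s →
                         Visits (from e₀ s) p × Visits (to e₀ s) p → Visits (from e₀ s₀) p
      endpoint-visited (inj₁ eq) (visits-from , _) = subst (λ w → Visits w p) (sym eq) visits-from
      endpoint-visited (inj₂ eq) (_ , visits-to)   = subst (λ w → Visits w p) (sym eq) visits-to
    walkFlow-simple (step e₀ s₀ _ _ _ p) (_ , p-simple) e | no e≢e₀
      rewrite ℤP.+-identityˡ (walkFlow p e) with walkFlow-simple p p-simple e
    ... | inj₁ (flow≡0 , unused) =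
      inj₁ (flow≡0 , λ { s (inj₁ (e≡e₀ , _)) → e≢e₀ e≡e₀ ; s (inj₂ use) → unused s use })
    ... | inj₂ (s , use , val) = inj₂ (s , inj₂ use , val)

    length : ∀ {u} → Walk u → ℕ
    length (stop _)           = 0
    length (step _ _ _ _ _ p) = suc (length p)

    vertex : ∀ {u} (p : Walk u) → Fin (suc (length p)) → V
    vertex (stop {x} _)             _      = x
    vertex (step {u} _ _ _ _ _ _)   fz     = u
    vertex (step _ _ _ _ _ p)       (fs i) = vertex p i

    edge : ∀ {u} (p : Walk u) → Fin (length p) → E
    edge (step e _ _ _ _ _) fz     = e
    edge (step _ _ _ _ _ p) (fs i) = edge p i

    vertex-first : ∀ {u} (p : Walk u) → vertex p fz ≡ u
    vertex-first (stop _)           = refl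
    vertex-first (step _ _ _ _ _ _) = refl

    vertex-last : ∀ {u} (p : Walk u) → vertex p (fromℕ (length p)) ≡ terminus p
    vertex-last (stop _)           = refl
    vertex-last (step _ _ _ _ _ p) = vertex-last p

    edge-joins : ∀ {u} (p : Walk u) i → Joins G (edge p i) (vertex p (inject₁ i)) (vertex p (fs i))
    edge-joins (step e s _ refl _ p) fz rewrite vertex-first p = from-to-joins e s
    edge-joins (step _ _ _ _ _ p) (fs i) = edge-joins p i

    visits-vertex : ∀ {u} (p : Walk u) i → Visits (vertex p i) p
    visits-vertex (stop _)           fz     = refl
    visits-vertex (step _ _ _ _ _ _) fz     = inj₁ refl
    visits-vertex (step _ _ _ _ _ p) (fs i) = inj₂ (visits-vertex p i)

    vertex-injective : ∀ {u} (p : Walk u) → Simple p → Injective _≡_ _≡_ (vertex p)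
    vertex-injective (stop _)           _            {fz}   {fz}   _  = refl
    vertex-injective (step _ _ _ _ _ _) _            {fz}   {fz}   _  = refl
    vertex-injective (step _ _ _ _ _ p) (u∉p , _)    {fz}   {fs j} eq =
      ⊥-elim (u∉p (subst (λ w → Visits w p) (sym eq) (visits-vertex p j)))
    vertex-injective (step _ _ _ _ _ p) (u∉p , _)    {fs i} {fz}   eq =
      ⊥-elim (u∉p (subst (λ w → Visits w p) eq (visits-vertex p i)))
    vertex-injective (step _ _ _ _ _ p) (_ , simple) {fs i} {fs j} eq = cong fs (vertex-injective p simple eq)

    vertex-inner∉X : ∀ {u} (p : Walk u) (i : Fin (suc (length p))) →
      toℕ i ℕ.< length p → X (vertex p i) ≡ false
    vertex-inner∉X (step _ _ _ refl u∉X _) fz     _          = u∉X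
    vertex-inner∉X (step _ _ _ _ _ p)      (fs i) (ℕ.s≤s lt) = vertex-inner∉X p i lt

    edge-used : ∀ {u} (p : Walk u) i → ∃ λ s → Uses (edge p i) s p
    edge-used (step e s _ _ _ _) fz = s , inj₁ (refl , refl)
    edge-used (step _ _ _ _ _ p) (fs i) with edge-used p i
    ... | s , use = s , inj₂ use

    toPath : ∀ {u} (p : Walk u) → Simple p → Path G
    toPath p simple = record
      { len = length p ; verts = vertex p ; edges = edge p
      ; adj = edge-joins p ; distinct = vertex-injective p simple }

    ReachesX : VSet G → Set
    ReachesX R = ∀ u → R u ≡ true →
      ∃ λ (p : Walk u) → Simple p × (∀ w → Visits w p → R w ≡ true)

    NoArcInto : VSet G → Set
    NoArcInto R = ∀ e s → A e s ≡ true → R (from e s) ≡ false → R (to e s) ≡ false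

    enters : VSet G → Bool → E → Bool
    enters R s e = A e s ∧ (not (R (from e s)) ∧ R (to e s))

    enters-true : ∀ R s e → enters R s e ≡ true →
      A e s ≡ true × R (from e s) ≡ false × R (to e s) ≡ true
    enters-true R s e hit with A e s | R (from e s) | R (to e s)
    ... | true | false | true = refl , refl , refl

    enters-false : ∀ R s e → enters R s e ≡ false →
      A e s ≡ true → R (from e s) ≡ false → R (to e s) ≡ false
    enters-false R s e miss a r rewrite a | r = miss

    arc-into-or-none : ∀ R → NoArcInto R ⊎
      (∃ λ e → ∃ λ s → A e s ≡ true × R (from e s) ≡ false × R (to e s) ≡ true)
    arc-into-or-none R with find-true (enters R true) | find-true (enters R false)
    ... | inj₁ (e , hit) | _              = inj₂ (e , true , enters-true R true e hit)
    ... | inj₂ _         | inj₁ (e , hit) = inj₂ (e , false , enters-true R false e hit)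
    ... | inj₂ none      | inj₂ none′     = inj₁ λ { e true  → enters-false R true e (none e)
                                                   ; e false → enters-false R false e (none′ e) }

    reachesX-insert : ∀ {R} → X ⊆ R → ReachesX R → ∀ e s →
      A e s ≡ true → R (from e s) ≡ false → R (to e s) ≡ true → ReachesX (insert (from e s) R)
    reachesX-insert {R} X⊆R reach e s a from∉R to∈R w w∈R′ with R w in Rw | w ≟ from e s
    ... | true | _ with reach w Rw
    ...   | p , simple , inside = p , simple , λ w′ → ⊆-insert (from e s) R w′ ∘ inside w′
    reachesX-insert X⊆R reach e s a from∉R to∈R w () | false | no _
    reachesX-insert {R} X⊆R reach e s a from∉R to∈R w _ | false | yes refl with reach (to e s) to∈R
    ... | p , simple , inside = step e s a refl from∉X p , (from∉p , simple) , inside′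
      where
      from∉X : X (from e s) ≡ false
      from∉X with X (from e s) in from∈X
      ... | true  = ⊥-elim (false≢true (trans (sym from∉R) (X⊆R _ from∈X)))
      ... | false = refl
      from∉p : ¬ Visits (from e s) p
      from∉p visit = false≢true (trans (sym from∉R) (inside _ visit))
      inside′ : ∀ w′ → Visits w′ (step e s a refl from∉X p) →
                insert (from e s) R w′ ≡ true
      inside′ _  (inj₁ refl)  = ∈-insert (from e s) R
      inside′ w′ (inj₂ visit) = ⊆-insert (from e s) R w′ (inside w′ visit)

    WalkOrBarrier : V → Set
    WalkOrBarrier v = (∃ λ (p : Walk v) → Simple p) ⊎
                      (∃ λ R → R v ≡ false × X ⊆ R × NoArcInto R)

    grow-reachable : ∀ v fuel R → X ⊆ R → ReachesX R →
      nV G ℕ.≤ fuel ℕ.+ count R → WalkOrBarrier v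
    grow-reachable v fuel R X⊆R reach bound with R v in Rv
    ... | true with reach v Rv
    ...   | p , simple , _ = inj₁ (p , simple)
    grow-reachable v zero R X⊆R reach bound | false =
      ⊥-elim (false≢true (trans (sym Rv) (count≥⇒all-true R bound v)))
    grow-reachable v (suc fuel) R X⊆R reach bound | false with arc-into-or-none R
    ... | inj₁ closed = inj₂ (R , Rv , X⊆R , closed)
    ... | inj₂ (e , s , a , from∉R , to∈R) =
      grow-reachable v fuel (insert (from e s) R) (λ u x → ⊆-insert (from e s) R u (X⊆R u x))
           (reachesX-insert X⊆R reach e s a from∉R to∈R)
           (ℕP.≤-trans bound (ℕP.≤-reflexive (begin
              suc fuel ℕ.+ count R             ≡⟨ ℕP.+-suc fuel (count R) ⟨
              fuel ℕ.+ suc (count R)           ≡⟨ cong (fuel ℕ.+_) (count-insert R from∉R) ⟨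
              fuel ℕ.+ count (insert (from e s) R) ∎)))
      where open ≡-Reasoning

    walk-or-barrier : ∀ v → WalkOrBarrier v
    walk-or-barrier v = grow-reachable v (nV G) X (λ _ x → x) (λ u x → stop x , tt , λ { w refl → x })
                             (ℕP.m≤m+n (nV G) (count X))

  UnitValue : ℤ → Set
  UnitValue x = x ≡ 0ℤ ⊎ x ≡ 1ℤ ⊎ x ≡ -1ℤ

  -- f e is the flow along e measured from src e to tgt e; the arc (e , s) is residual if a unit
  -- can still be pushed along it, and carrying if f already sends a unit along it.
  residual carrying : (E → ℤ) → E → Bool → Bool
  residual f e s = not (does (f e ℤ.≟ sgn s))
  carrying f e s = does (f e ℤ.≟ sgn s)

  unit-+-sgn : ∀ {x} s → UnitValue x → x ≢ sgn s → UnitValue (x + 1ℤ * sgn s)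
  unit-+-sgn true  (inj₁ refl)        _  = inj₂ (inj₁ refl)
  unit-+-sgn false (inj₁ refl)        _  = inj₂ (inj₂ refl)
  unit-+-sgn true  (inj₂ (inj₁ refl)) ≢s = ⊥-elim (≢s refl)
  unit-+-sgn false (inj₂ (inj₁ refl)) _  = inj₁ refl
  unit-+-sgn true  (inj₂ (inj₂ refl)) _  = inj₁ refl
  unit-+-sgn false (inj₂ (inj₂ refl)) ≢s = ⊥-elim (≢s refl)

  sgn-cancel : ∀ s → sgn s + -1ℤ * sgn s ≡ 0ℤ
  sgn-cancel true  = refl
  sgn-cancel false = refl

  complement : VSet G → VSet G
  complement R u = not (R u)

  crosses : VSet G → E → Bool
  crosses U e = U (src e) xor U (tgt e)

  EdgeDisjoint : ∀ {j} → (Fin j → Path G) → Set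
  EdgeDisjoint Ps = ∀ i i′ → i ≢ i′ → ∀ a b → edges (Ps i) a ≢ edges (Ps i′) b

  edgeDisjoint-∷ : ∀ {j} {P} {Ps : Fin j → Path G} → EdgeDisjoint Ps →
    (∀ i a b → edges P a ≢ edges (Ps i) b) → EdgeDisjoint (P ◃ Ps)
  edgeDisjoint-∷ disjoint new fz     fz      0≢0 = ⊥-elim (0≢0 refl)
  edgeDisjoint-∷ disjoint new fz     (fs i′) _   a b = new i′ a b
  edgeDisjoint-∷ disjoint new (fs i) fz      _   a b = ≢-sym (new i b a)
  edgeDisjoint-∷ disjoint new (fs i) (fs i′) i≢i′ = disjoint i i′ (i≢i′ ∘ cong fs)

  Confined : VSet G → VSet G → Set
  Confined X S = ∀ u → S u ≡ true → X u ≡ false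

  Small : VSet G → ℕ → VSet G → Set
  Small X k S = Confined X S × δsize G S ℕ.< k

  module Flows (X : VSet G) (v : V) (v∉X : X v ≡ false) where

    open Walks X

    Conserved : (E → ℤ) → Set
    Conserved f = ∀ u → X u ≡ false → u ≢ v → outflow f u ≡ 0ℤ

    IsFlow : ℕ → (E → ℤ) → Set
    IsFlow j f = (∀ e → UnitValue (f e)) × outflow f v ≡ + j × Conserved f

    shift : ℤ → (E → ℤ) → ∀ {A u} → Walk A u → E → ℤ
    shift c f {A} p e = f e + c * walkFlow A p e

    outflow-shift : ∀ c f {A} (p : Walk A v) w →
      outflow (shift c f p) w ≡ outflow f w + c * (⟦ w ≟ v ⟧ - ⟦ w ≟ terminus A p ⟧)
    outflow-shift c f {A} p w =
      trans (outflow-+ f (λ e → c * walkFlow A p e) w)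
            (cong (_+_ (outflow f w)) (trans (outflow-* c (walkFlow A p) w)
                                             (cong (c *_) (outflow-walkFlow A p w))))

    terminus≢ : ∀ {A} (p : Walk A v) {u} → X u ≡ false → terminus A p ≢ u
    terminus≢ {A} p u∉X eq =
      false≢true (trans (sym u∉X) (trans (cong X (sym eq)) (terminus∈X A p)))

    shift-conserved : ∀ c f {A} (p : Walk A v) → Conserved f → Conserved (shift c f p)
    shift-conserved c f p conserved u u∉X u≢v
      rewrite outflow-shift c f p u | conserved u u∉X u≢v | ⟦≟⟧-≢ u≢v
            | ⟦≟⟧-≢ (≢-sym (terminus≢ p u∉X)) | ℤP.*-zeroʳ c = refl

    shift-value : ∀ c f {A} (p : Walk A v) → outflow (shift c f p) v ≡ outflow f v + c
    shift-value c f p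
      rewrite outflow-shift c f p v | ⟦≟⟧-refl v | ⟦≟⟧-≢ (≢-sym (terminus≢ p v∉X))
            | ℤP.*-identityʳ c = refl

    shift-unit : ∀ c f {A} (p : Walk A v) → Simple A p → (∀ e → UnitValue (f e)) →
      (∀ e s → Uses A e s p → UnitValue (f e + c * sgn s)) → ∀ e → UnitValue (shift c f p e)
    shift-unit c f {A} p simple unit used e with walkFlow-simple A p simple e
    ... | inj₁ (flow≡0 , _) rewrite flow≡0 | ℤP.*-zeroʳ c | ℤP.+-identityʳ (f e) = unit e
    ... | inj₂ (s , use , flow≡sgn) rewrite flow≡sgn = used e s use

    carried-cancels : ∀ f {u e s} (p : Walk (carrying f) u) → Uses (carrying f) e s p →
      f e + -1ℤ * sgn s ≡ 0ℤ
    carried-cancels f {e = e} {s} p use =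
      trans (cong (_+ -1ℤ * sgn s) (does⇒ (f e ℤ.≟ sgn s) (uses⇒admissible (carrying f) p use)))
            (sgn-cancel s)

    augment : ∀ {j f} → IsFlow j f → (p : Walk (residual f) v) → Simple (residual f) p →
      IsFlow (suc j) (shift 1ℤ f p)
    augment {j} {f} (unit , value , conserved) p simple =
        shift-unit 1ℤ f p simple unit room
      , trans (shift-value 1ℤ f p) (trans (cong (_+ 1ℤ) value) (cong +_ (ℕP.+-comm j 1)))
      , shift-conserved 1ℤ f p conserved
      where
      room : ∀ e s → Uses (residual f) e s p → UnitValue (f e + 1ℤ * sgn s)
      room e s use =
        unit-+-sgn s (unit e) (not-does⇒¬ (f e ℤ.≟ sgn s) (uses⇒admissible (residual f) p use))

    cancel : ∀ {j f} → IsFlow (suc j) f → (p : Walk (carrying f) v) → Simple (carrying f) p →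
      IsFlow j (shift -1ℤ f p)
    cancel {j} {f} (unit , value , conserved) p simple =
        shift-unit -1ℤ f p simple unit (λ e s use → inj₁ (carried-cancels f p use))
      , trans (shift-value -1ℤ f p) (cong (_+ -1ℤ) value)
      , shift-conserved -1ℤ f p conserved

    outside : VSet G → V → ℤ
    outside R u = + 𝟙 (not (R u))

    outflow-outside : ∀ {j f R} → IsFlow j f → R v ≡ false → X ⊆ R →
      sum (λ u → outside R u * outflow f u) ≡ + j
    outflow-outside {j} {f} {R} (_ , value , conserved) v∉R X⊆R = begin
      sum (λ u → outside R u * outflow f u) ≡⟨ sum-single _ v vanish ⟩
      outside R v * outflow f v            ≡⟨ cong (λ b → + 𝟙 (not b) * outflow f v) v∉R ⟩
      1ℤ * outflow f v                     ≡⟨ ℤP.*-identityˡ _ ⟩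
      outflow f v                          ≡⟨ value ⟩
      + j                                  ∎
      where
      open ≡-Reasoning
      vanish : ∀ u → u ≢ v → outside R u * outflow f u ≡ 0ℤ
      vanish u u≢v with R u in Ru | X u in Xu
      ... | true  | _     = ℤP.*-zeroˡ (outflow f u)
      ... | false | true  = ⊥-elim (false≢true (trans (sym Ru) (X⊆R u Xu)))
      ... | false | false = cong (1ℤ *_) (conserved u Xu u≢v)

    residual-barrier-size : ∀ {j f R} → IsFlow j f → R v ≡ false → X ⊆ R →
      NoArcInto (residual f) R → δsize G (complement R) ≡ j
    residual-barrier-size {j} {f} {R} flow v∉R X⊆R closed = ℤP.+-injective (begin
      + δsize G (complement R)                                    ≡⟨ sum-𝟙 (crosses (complement R)) ⟨
      sum (λ e → + 𝟙 (crosses (complement R) e))                  ≡⟨ sum-cong-≗ crossing ⟨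
      sum (λ e → f e * (outside R (src e) - outside R (tgt e)))   ≡⟨ sum-by-parts (outside R) f ⟨
      sum (λ u → outside R u * outflow f u)                       ≡⟨ outflow-outside flow v∉R X⊆R ⟩
      + j                                                         ∎)
      where
      open ≡-Reasoning
      saturated : ∀ e s → R (from e s) ≡ false → R (to e s) ≡ true → f e ≡ sgn s
      saturated e s out in′ with f e ℤ.≟ sgn s
      ... | yes eq  = eq
      ... | no  neq = ⊥-elim (false≢true (trans (sym (closed e s room out)) in′))
        where room = cong not (dec-false (f e ℤ.≟ sgn s) neq)
      crossing : ∀ e → f e * (outside R (src e) - outside R (tgt e)) ≡ + 𝟙 (crosses (complement R) e)
      crossing e with R (src e) in Rs | R (tgt e) in Rt
      ... | true  | true  = ℤP.*-zeroʳ (f e)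
      ... | false | false = ℤP.*-zeroʳ (f e)
      ... | false | true  rewrite saturated e true  Rs Rt = refl
      ... | true  | false rewrite saturated e false Rt Rs = refl

    no-carrying-barrier : ∀ {j f R} → IsFlow (suc j) f → R v ≡ false → X ⊆ R →
      ¬ NoArcInto (carrying f) R
    no-carrying-barrier {j} {f} {R} flow v∉R X⊆R closed = positive (begin
      + suc j                                                     ≡⟨ outflow-outside flow v∉R X⊆R ⟨
      sum (λ u → outside R u * outflow f u)                       ≡⟨ sum-by-parts (outside R) f ⟩
      sum (λ e → f e * (outside R (src e) - outside R (tgt e)))   ≤⟨ sum-mono-≤ crossing ⟩
      sum zero-on-E                                               ≡⟨ sum-zero {f = zero-on-E} (λ _ → refl) ⟩
      0ℤ                                                          ∎)
      where
      open ℤP.≤-Reasoning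
      zero-on-E : E → ℤ
      zero-on-E _ = 0ℤ
      positive : ¬ (+ suc j ℤ.≤ 0ℤ)
      positive (ℤ.+≤+ ())
      unsaturated : ∀ e s → R (from e s) ≡ false → R (to e s) ≡ true → f e ≢ sgn s
      unsaturated e s out in′ eq =
        false≢true (trans (sym (closed e s (dec-true (f e ℤ.≟ sgn s) eq) out)) in′)
      crossing : ∀ e → f e * (outside R (src e) - outside R (tgt e)) ℤ.≤ zero-on-E e
      crossing e with R (src e) in Rs | R (tgt e) in Rt | proj₁ flow e
      ... | true  | true  | _ = ℤP.≤-reflexive (ℤP.*-zeroʳ (f e))
      ... | false | false | _ = ℤP.≤-reflexive (ℤP.*-zeroʳ (f e))
      ... | false | true  | inj₁ f≡0 rewrite f≡0 = ℤP.≤-refl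
      ... | false | true  | inj₂ (inj₂ f≡-1) rewrite f≡-1 = ℤ.-≤+
      ... | false | true  | inj₂ (inj₁ f≡1) = ⊥-elim (unsaturated e true Rs Rt f≡1)
      ... | true  | false | inj₁ f≡0 rewrite f≡0 = ℤP.≤-refl
      ... | true  | false | inj₂ (inj₁ f≡1) rewrite f≡1 = ℤ.-≤+
      ... | true  | false | inj₂ (inj₂ f≡-1) = ⊥-elim (unsaturated e false Rt Rs f≡-1)

    IsLeg : Path G → Set
    IsLeg P = start P ≡ v × X (end P) ≡ true ×
              (∀ j → 0 ℕ.< toℕ j → toℕ j ℕ.< len P → X (verts P j) ≡ false)

    spider : ∀ {k} (Ps : Fin k → Path G) → (∀ i → IsLeg (Ps i)) → EdgeDisjoint Ps →
      IsSpider G X k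
    spider Ps legs disjoint =
      v , v∉X , Ps , proj₁ ∘ legs , proj₁ ∘ proj₂ ∘ legs , proj₂ ∘ proj₂ ∘ legs , disjoint

    walk-leg : ∀ {A} (p : Walk A v) (simple : Simple A p) → IsLeg (toPath A p simple)
    walk-leg {A} p simple =
        vertex-first A p
      , trans (cong X (vertex-last A p)) (terminus∈X A p)
      , λ j _ → vertex-inner∉X A p j

    zero-flow : IsFlow 0 (λ _ → 0ℤ)
    zero-flow = (λ _ → inj₁ refl) , outflow-zero v , λ u _ _ → outflow-zero u
      where
      outflow-zero : ∀ u → outflow (λ _ → 0ℤ) u ≡ 0ℤ
      outflow-zero u = sum-zero λ e → ℤP.*-zeroˡ (incidence e u)

    flow-or-cut : ∀ k j → j ℕ.≤ k → ∃ (IsFlow j) ⊎ ∃ λ S → S v ≡ true × Small X k S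
    flow-or-cut k zero    _   = inj₁ (_ , zero-flow)
    flow-or-cut k (suc j) j<k with flow-or-cut k j (ℕP.<⇒≤ j<k)
    ... | inj₂ cut = inj₂ cut
    ... | inj₁ (f , flow) with walk-or-barrier (residual f) v
    ...   | inj₁ (p , simple) = inj₁ (_ , augment flow p simple)
    ...   | inj₂ (R , v∉R , X⊆R , closed) =
      inj₂ (complement R , cong not v∉R , inside⇒∉X ,
            subst (ℕ._< k) (sym (residual-barrier-size flow v∉R X⊆R closed)) j<k)
      where
      inside⇒∉X : Confined X (complement R)
      inside⇒∉X u u∉R with X u in Xu
      ... | false = refl
      ... | true rewrite X⊆R u Xu = ⊥-elim (false≢true u∉R)

    module _ (f : E → ℤ) (p : Walk (carrying f) v) (simple : Simple (carrying f) p) where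

      cancelled : ∀ e → shift -1ℤ f p e ≡ 0ℤ ⊎
                        (shift -1ℤ f p e ≡ f e × ∀ s → ¬ Uses (carrying f) e s p)
      cancelled e with walkFlow-simple (carrying f) p simple e
      ... | inj₁ (flow≡0 , unused) rewrite flow≡0 = inj₂ (ℤP.+-identityʳ (f e) , unused)
      ... | inj₂ (s , use , flow≡sgn) rewrite flow≡sgn = inj₁ (carried-cancels f p use)

      cancelled-on-walk : ∀ a → shift -1ℤ f p (edge (carrying f) p a) ≡ 0ℤ
      cancelled-on-walk a with edge-used (carrying f) p a
      ... | s , use with cancelled (edge (carrying f) p a)
      ...   | inj₁ cleared      = cleared
      ...   | inj₂ (_ , unused) = ⊥-elim (unused s use)

      cancelled-support : ∀ e → shift -1ℤ f p e ≢ 0ℤ → f e ≢ 0ℤ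
      cancelled-support e nonzero with cancelled e
      ... | inj₁ cleared    = ⊥-elim (nonzero cleared)
      ... | inj₂ (same , _) = nonzero ∘ trans same

      walk-support : ∀ a → f (edge (carrying f) p a) ≢ 0ℤ
      walk-support a with edge-used (carrying f) p a
      ... | s , use = sgn≢0 s ∘ trans (sym (does⇒ (_ ℤ.≟ sgn s) (uses⇒admissible (carrying f) p use)))
        where
        sgn≢0 : ∀ s → sgn s ≢ 0ℤ
        sgn≢0 true  ()
        sgn≢0 false ()

    -- The support condition keeps the first leg edge-disjoint from the legs of the cancelled flow.
    decompose : ∀ j f → IsFlow j f → ∃ λ (Ps : Fin j → Path G) →
      (∀ i → IsLeg (Ps i)) × EdgeDisjoint Ps × (∀ i a → f (edges (Ps i) a) ≢ 0ℤ)
    decompose zero    f _    = (λ ()) , (λ ()) , (λ ()) , (λ ())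
    decompose (suc j) f flow with walk-or-barrier (carrying f) v
    ... | inj₂ (R , v∉R , X⊆R , closed) = ⊥-elim (no-carrying-barrier flow v∉R X⊆R closed)
    ... | inj₁ (p , simple) with decompose j (shift -1ℤ f p) (cancel flow p simple)
    ...   | Ps , legs , disjoint , support =
        toPath (carrying f) p simple ◃ Ps
      , (λ { fz → walk-leg p simple ; (fs i) → legs i })
      , edgeDisjoint-∷ disjoint (λ i a b same →
          support i b (trans (cong (shift -1ℤ f p) (sym same)) (cancelled-on-walk f p simple a)))
      , λ { fz → walk-support f p simple ; (fs i) a → cancelled-support f p simple _ (support i a) }

    spider-or-cut : ∀ k → IsSpider G X k ⊎ ∃ λ S → S v ≡ true × Small X k S
    spider-or-cut k with flow-or-cut k k ℕP.≤-refl
    ... | inj₂ cut = inj₂ cut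
    ... | inj₁ (f , flow) with decompose k f flow
    ...   | Ps , legs , disjoint , _ = inj₁ (spider Ps legs disjoint)


  _∖_ : VSet G → VSet G → VSet G
  (A ∖ B) u = A u ∧ not (B u)

  δ-posimodular : ∀ A B → δsize G (A ∖ B) ℕ.+ δsize G (B ∖ A) ℕ.≤ δsize G A ℕ.+ δsize G B
  δ-posimodular A B =
    count-+-mono-≤ λ e → edge-posimodular (A (src e)) (A (tgt e)) (B (src e)) (B (tgt e))
    where
    edge-posimodular : ∀ a₁ a₂ b₁ b₂ →
      𝟙 ((a₁ ∧ not b₁) xor (a₂ ∧ not b₂)) ℕ.+ 𝟙 ((b₁ ∧ not a₁) xor (b₂ ∧ not a₂))
        ℕ.≤ 𝟙 (a₁ xor a₂) ℕ.+ 𝟙 (b₁ xor b₂)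
    edge-posimodular true  true  true  true  = ℕ.z≤n
    edge-posimodular true  true  true  false = ℕ.s≤s ℕ.z≤n
    edge-posimodular true  true  false true  = ℕ.s≤s ℕ.z≤n
    edge-posimodular true  true  false false = ℕ.z≤n
    edge-posimodular true  false true  true  = ℕ.s≤s ℕ.z≤n
    edge-posimodular true  false true  false = ℕ.z≤n
    edge-posimodular true  false false true  = ℕ.s≤s (ℕ.s≤s ℕ.z≤n)
    edge-posimodular true  false false false = ℕ.s≤s ℕ.z≤n
    edge-posimodular false true  true  true  = ℕ.s≤s ℕ.z≤n
    edge-posimodular false true  true  false = ℕ.s≤s (ℕ.s≤s ℕ.z≤n)
    edge-posimodular false true  false true  = ℕ.z≤n
    edge-posimodular false true  false false = ℕ.s≤s ℕ.z≤n
    edge-posimodular false false true  true  = ℕ.z≤n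
    edge-posimodular false false true  false = ℕ.s≤s ℕ.z≤n
    edge-posimodular false false false true  = ℕ.s≤s ℕ.z≤n
    edge-posimodular false false false false = ℕ.z≤n

  ⋃ : List (VSet G) → VSet G
  ⋃ []      u = false
  ⋃ (C ∷ F) u = C u ∨ ⋃ F u

  Disjoint : List (VSet G) → Set
  Disjoint []      = ⊤
  Disjoint (C ∷ F) = (∀ u → C u ∧ ⋃ F u ≡ false) × Disjoint F

  ⋃-∷ : ∀ (A : VSet G) F {u} → ⋃ F u ≡ true → A u ∨ ⋃ F u ≡ true
  ⋃-∷ A F {u} hit rewrite hit = ∨-zeroʳ (A u)

  NonEmpty : VSet G → Set
  NonEmpty C = ∃ λ w → C w ≡ true

  -- Vertices in no member of C ∷ F are sent to C.
  locate : VSet G → (F : List (VSet G)) → V → Fin (suc (List.length F))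
  locate C []      u = fz
  locate C (D ∷ F) u = if C u then fz else fs (locate D F u)

  lookup-locate : ∀ (C : VSet G) F u → ⋃ (C ∷ F) u ≡ true →
    List.lookup (C ∷ F) (locate C F u) u ≡ true
  lookup-locate C []      u hit rewrite ∨-identityʳ (C u) = hit
  lookup-locate C (D ∷ F) u hit with C u in Cu
  ... | true  = Cu
  ... | false = lookup-locate D F u hit

  lookup⇒⋃ : ∀ (F : List (VSet G)) i {u} → List.lookup F i u ≡ true → ⋃ F u ≡ true
  lookup⇒⋃ (C ∷ F) fz     {u} hit rewrite hit = refl
  lookup⇒⋃ (C ∷ F) (fs i) {u} hit = ⋃-∷ C F (lookup⇒⋃ F i hit)

  lookup-unique : ∀ F → Disjoint F → ∀ {u} i j →
    List.lookup F i u ≡ true → List.lookup F j u ≡ true → i ≡ j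
  lookup-unique (C ∷ F) _              fz     fz     _   _    = refl
  lookup-unique (C ∷ F) (C-apart , _)  fz     (fs j) hit hit′ =
    ⊥-elim (both-true (C-apart _) hit (lookup⇒⋃ F j hit′))
  lookup-unique (C ∷ F) (C-apart , _)  (fs i) fz     hit hit′ =
    ⊥-elim (both-true (C-apart _) hit′ (lookup⇒⋃ F i hit))
  lookup-unique (C ∷ F) (_ , disjoint) (fs i) (fs j) hit hit′ =
    cong fs (lookup-unique F disjoint i j hit hit′)

  confined-∖ : ∀ {X} A B → Confined X A → Confined X (A ∖ B)
  confined-∖ A B confined u A∖B∋u with A u in Au
  ... | true = confined u Au

  module Uncrossing (X : VSet G) (k : ℕ) where

    -- If A ∖ B is small it takes the place of A; otherwise B ∖ A is small by posimodularity and
    -- takes the place of B.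
    adjoin : ∀ A F → Small X k A → All (Small X k) F → Disjoint F →
      ∃ λ F′ → All (Small X k) F′ × Disjoint F′ × (∀ u → ⋃ F′ u ≡ A u ∨ ⋃ F u)
    adjoin A []      small-A _ _ = A ∷ [] , small-A ∷ [] , ((λ u → ∧-zeroʳ (A u)) , tt) , λ _ → refl
    adjoin A (B ∷ F) small-A (small-B ∷ smalls) (B-apart , disjoint) with δsize G (A ∖ B) ℕ.<? k
    ... | yes A∖B-small with adjoin (A ∖ B) F (confined-∖ A B (proj₁ small-A) , A∖B-small) smalls disjoint
    ...   | F′ , smalls′ , disjoint′ , union′ =
      B ∷ F′ , small-B ∷ smalls′ , (B-apart′ , disjoint′) , union″
      where
      B-apart′ : ∀ u → B u ∧ ⋃ F′ u ≡ false
      B-apart′ u = trans (cong (B u ∧_) (union′ u)) (keep-apart (A u) (B u) (B-apart u))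
      union″ : ∀ u → B u ∨ ⋃ F′ u ≡ A u ∨ (B u ∨ ⋃ F u)
      union″ u = trans (cong (B u ∨_) (union′ u)) (keep-union (A u) (B u) (⋃ F u))
    adjoin A (B ∷ F) small-A (small-B ∷ smalls) (B-apart , disjoint) | no A∖B-large
      with adjoin A F small-A smalls disjoint
    ... | F′ , smalls′ , disjoint′ , union′ =
      B ∖ A ∷ F′ , (confined-∖ B A (proj₁ small-B) , B∖A-small) ∷ smalls′
               , (B∖A-apart , disjoint′) , union″
      where
      B∖A-small : δsize G (B ∖ A) ℕ.< k
      B∖A-small = ℕP.+-cancelˡ-< k _ _ (begin-strict
        k ℕ.+ δsize G (B ∖ A)                 ≤⟨ ℕP.+-monoˡ-≤ _ (ℕP.≮⇒≥ A∖B-large) ⟩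
        δsize G (A ∖ B) ℕ.+ δsize G (B ∖ A)   ≤⟨ δ-posimodular A B ⟩
        δsize G A ℕ.+ δsize G B               <⟨ ℕP.+-mono-< (proj₂ small-A) (proj₂ small-B) ⟩
        k ℕ.+ k                               ∎)
        where open ℕP.≤-Reasoning
      B∖A-apart : ∀ u → (B ∖ A) u ∧ ⋃ F′ u ≡ false
      B∖A-apart u = trans (cong ((B ∖ A) u ∧_) (union′ u)) (replace-apart (A u) (B u) (B-apart u))
      union″ : ∀ u → (B ∖ A) u ∨ ⋃ F′ u ≡ A u ∨ (B u ∨ ⋃ F u)
      union″ u = trans (cong ((B ∖ A) u ∨_) (union′ u)) (replace-union (A u) (B u) (⋃ F u))

    prune : ∀ F → All (Small X k) F → Disjoint F →
      ∃ λ F′ → All (Small X k) F′ × Disjoint F′ × All NonEmpty F′ × (∀ u → ⋃ F′ u ≡ ⋃ F u)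
    prune []      []               _                   = [] , [] , tt , [] , λ _ → refl
    prune (C ∷ F) (small ∷ smalls) (C-apart , disjoint) with prune F smalls disjoint | find-true C
    ... | F′ , smalls′ , disjoint′ , nonempty′ , union′ | inj₁ (w , Cw) =
        C ∷ F′ , small ∷ smalls′
      , ((λ u → trans (cong (C u ∧_) (union′ u)) (C-apart u)) , disjoint′)
      , (w , Cw) ∷ nonempty′
      , λ u → cong (C u ∨_) (union′ u)
    ... | F′ , smalls′ , disjoint′ , nonempty′ , union′ | inj₂ empty =
        F′ , smalls′ , disjoint′ , nonempty′
      , λ u → trans (union′ u) (cong (_∨ ⋃ F u) (sym (empty u)))

    spider-or-cover : ∀ n (g : Fin n → V) → IsSpider G X k ⊎
      (∃ λ F → All (Small X k) F × Disjoint F × (∀ i → X (g i) ≡ false → ⋃ F (g i) ≡ true))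
    spider-or-cover zero    g = inj₂ ([] , [] , tt , λ ())
    spider-or-cover (suc n) g with spider-or-cover n (g ∘ fs) | X (g fz) in Xg
    ... | inj₁ found | _ = inj₁ found
    ... | inj₂ (F , smalls , disjoint , covered) | true = inj₂ (F , smalls , disjoint , covered′)
      where
      covered′ : ∀ i → X (g i) ≡ false → ⋃ F (g i) ≡ true
      covered′ fz     g∉X = ⊥-elim (false≢true (trans (sym g∉X) Xg))
      covered′ (fs i)     = covered i
    ... | inj₂ (F , smalls , disjoint , covered) | false with Flows.spider-or-cut X (g fz) Xg k
    ...   | inj₁ found = inj₁ found
    ...   | inj₂ (S , Sg , small) with adjoin S F small smalls disjoint
    ...     | F′ , smalls′ , disjoint′ , union′ = inj₂ (F′ , smalls′ , disjoint′ , covered′)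
      where
      covered′ : ∀ i → X (g i) ≡ false → ⋃ F′ (g i) ≡ true
      covered′ fz     _   = trans (union′ (g fz)) (cong (_∨ ⋃ F (g fz)) Sg)
      covered′ (fs i) g∉X = trans (union′ (g (fs i))) (⋃-∷ S F (covered i g∉X))

    family⇒partition : ∀ C F → All (Small X k) (C ∷ F) → Disjoint (C ∷ F) →
      All NonEmpty (C ∷ F) → (∀ u → X u ≡ false → ⋃ (C ∷ F) u ≡ true) → HasSmallPartition G X k
    family⇒partition C F smalls disjoint nonempty covers =
        suc (List.length F) , locate C F
      , (λ i → let w , hit = member nonempty i in w , trans (part≡lookup i w) hit)
      , (λ i → subst (ℕ._< k) (sym (count-cong (same-crossings i))) (proj₂ (member smalls i)))
      where
      member : ∀ {P : VSet G → Set} → All P (C ∷ F) → ∀ i → P (List.lookup (C ∷ F) i)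
      member ps i = All.lookup ps (∈-lookup i)
      part≡lookup : ∀ i u → Part G X (locate C F) i u ≡ List.lookup (C ∷ F) i u
      part≡lookup i u with X u in Xu | List.lookup (C ∷ F) i u in hit
      ... | true  | false = refl
      ... | true  | true  = ⊥-elim (false≢true (trans (sym (proj₁ (member smalls i) u hit)) Xu))
      ... | false | false with locate C F u ≟ i
      ...   | yes refl = ⊥-elim (false≢true (trans (sym hit) (lookup-locate C F u (covers u Xu))))
      ...   | no  _    = refl
      part≡lookup i u | false | true with locate C F u ≟ i
      ...   | yes _    = refl
      ...   | no  ≢i   = ⊥-elim (≢i (lookup-unique (C ∷ F) disjoint _ i (lookup-locate C F u (covers u Xu)) hit))
      same-crossings : ∀ i e → crosses (Part G X (locate C F) i) e ≡ crosses (List.lookup (C ∷ F) i) e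
      same-crossings i e = cong₂ _xor_ (part≡lookup i (src e)) (part≡lookup i (tgt e))

    ¬partition⇒spider : (∃ λ w → X w ≡ false) → ¬ HasSmallPartition G X k → IsSpider G X k
    ¬partition⇒spider (w , w∉X) no-partition with spider-or-cover (nV G) (λ u → u)
    ... | inj₁ found = found
    ... | inj₂ (F , smalls , disjoint , covered) with prune F smalls disjoint
    ...   | [] , _ , _ , _ , union = ⊥-elim (false≢true (trans (union w) (covered w w∉X)))
    ...   | C ∷ F′ , smalls′ , disjoint′ , nonempty′ , union = ⊥-elim (no-partition
      (family⇒partition C F′ smalls′ disjoint′ nonempty′ λ u u∉X → trans (union u) (covered u u∉X)))

  joins-crosses : ∀ U {e a b} → Joins G e a b → U a ≡ true → U b ≡ false → crosses U e ≡ true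
  joins-crosses U (inj₁ refl) Ua Ub rewrite Ua | Ub = refl
  joins-crosses U (inj₂ refl) Ua Ub rewrite Ua | Ub = refl

  path-exit : ∀ U (P : Path G) → U (start P) ≡ true → U (end P) ≡ false →
    ∃ λ a → crosses U (edges P a) ≡ true
  path-exit U P inside outside with first-exit (U ∘ verts P) inside outside
  ... | a , Ua , Ua′ = a , joins-crosses U (adj P a) Ua Ua′

  disjoint-exits : ∀ {k} U (Ps : Fin k → Path G) → EdgeDisjoint Ps →
    (∀ i → U (start (Ps i)) ≡ true) → (∀ i → U (end (Ps i)) ≡ false) → k ℕ.≤ δsize G U
  disjoint-exits U Ps disjoint inside outside =
    injection⇒≤count (crosses U) exit-edge injective (proj₂ ∘ exit)
    where
    exit : ∀ i → ∃ λ a → crosses U (edges (Ps i) a) ≡ true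
    exit i = path-exit U (Ps i) (inside i) (outside i)
    exit-edge : Fin _ → E
    exit-edge i = edges (Ps i) (proj₁ (exit i))
    injective : Injective _≡_ _≡_ exit-edge
    injective {i} {j} same with i ≟ j
    ... | yes i≡j = i≡j
    ... | no  i≢j = ⊥-elim (disjoint i j i≢j _ _ same)

  spider⇒¬partition : ∀ X k → IsSpider G X k → ¬ HasSmallPartition G X k
  spider⇒¬partition X k (v , v∉X , Ps , starts , ends , _ , disjoint) (p , c , _ , small) =
    ℕP.<⇒≱ (small (c v)) (disjoint-exits U Ps disjoint (λ i → trans (cong U (starts i)) U∋v) (U∌X ∘ ends))
    where
    U : VSet G
    U = Part G X c (c v)
    U∋v : U v ≡ true
    U∋v rewrite v∉X | isYes≗does (c v ≟ c v) = dec-true (c v ≟ c v) refl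
    U∌X : ∀ {w} → X w ≡ true → U w ≡ false
    U∌X Xw rewrite Xw = refl

  vertex-outside : ∀ X → 0 ℕ.< δsize G X → ∃ λ w → X w ≡ false
  vertex-outside X crossing-edges with count>0⇒∃ (crosses X) crossing-edges
  ... | e , crossing with X (src e) in Xs | X (tgt e) in Xt
  ... | false | _     = src e , Xs
  ... | true  | false = tgt e , Xt
  ... | true  | true  = ⊥-elim (false≢true crossing)

open import Data.Nat using (_≤_; _*_)

3k≤2d⇒0<d : ∀ {k d} → 1 ≤ k → 3 * k ≤ 2 * d → 0 ℕ.< d
3k≤2d⇒0<d {d = zero}  k≥1 bound with ℕP.≤-trans (ℕP.*-monoʳ-≤ 3 k≥1) bound
... | ()
3k≤2d⇒0<d {d = suc d} _   _     = ℕ.s≤s ℕ.z≤n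

-- The bound is used only to find a vertex outside X.
lemma3 : (G : Graph) (X : VSet G) (k : ℕ) → 1 ≤ k → 3 * k ≤ 2 * δsize G X →
    (IsSpider G X k ⇔ (¬ HasSmallPartition G X k))
lemma3 G X k k≥1 bound =
  mk⇔ (spider⇒¬partition G X k)
      (Uncrossing.¬partition⇒spider G X k (vertex-outside G X (3k≤2d⇒0<d k≥1 bound)))
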